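{- Let $Q=(q_n)_{n\ge1}$ be a basic sequence that is infinite in limit, with associated sequence $(l_j)_{j\ge1}$. For integers $i\ge1$ and real $w,z\ge0$ define $$f_i(w,z)=\frac{\left(\sum_{j=1}^i 2l_j\right)+2w+z}{\left(\sum_{j=1}^i jl_j\right)+(i+1)w+z}.$$ If $i>2$, $\sum_{j=1}^i jl_j>\sum_{j=1}^i 2l_j$, and $(w,z)\in\{0,1,\dots,l_{i+1}\}\times\{0,1,\dots,i\}$, then $$f_i(w,z)<f_i(0,i+1)=\frac{\left(\sum_{j=1}^i 2l_j\right)+i+1}{\left(\sum_{j=1}^i jl_j\right)+i+1}.$$
   Context: A basic sequence is a sequence $Q=(q_n)_{n\ge1}$ of integers with $q_n\ge 2$; it is infinite in limit if $q_n\to\infty$. For each positive integer $j$ let $\nu_j=\min\{N: q_m\ge 2j^2 \text{ for all } m\ge N\}$. Let $l_1=\max(\nu_2-1,1)$ and, recursively for $i\ge2$, let $l_i$ be the smallest positive integer $k$ with $l_1+2l_2+\cdots+(i-1)l_{i-1}+ik\ge \nu_{i+1}-1$. -}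

module Defs where

open import Data.Nat using (ℕ; zero; suc; _+_; _*_; _∸_; _⊔_; _≤_; _<_)
open import Data.Integer using (+_)
open import Data.Rational using (ℚ; 0ℚ; _/_)
open import Data.Product using (Σ; _×_)
open import Relation.Nullary using (¬_)
open import Relation.Binary.PropositionalEquality using (_≡_)

-- A sequence Q = (q_n)_{n ≥ 1} is modelled as ℕ → ℕ; the value at 0 is ignored.
Basic : (ℕ → ℕ) → Set
Basic q = ∀ n → 1 ≤ n → 2 ≤ q n

InfiniteInLimit : (ℕ → ℕ) → Set
InfiniteInLimit q = ∀ M → Σ ℕ λ N → ∀ n → N ≤ n → M ≤ q n

TailBound : (ℕ → ℕ) → ℕ → ℕ → Set
TailBound q j N = ∀ m → N ≤ m → 2 * (j * j) ≤ q m

IsNu : (ℕ → ℕ) → (ℕ → ℕ) → Set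
IsNu q ν = ∀ j → 1 ≤ j →
  (1 ≤ ν j) × TailBound q j (ν j) × (∀ N → 1 ≤ N → N < ν j → ¬ TailBound q j N)

sumTo : (ℕ → ℕ) → ℕ → ℕ
sumTo g zero = 0
sumTo g (suc i) = sumTo g i + g (suc i)

weightedSum : (ℕ → ℕ) → ℕ → ℕ
weightedSum l = sumTo (λ j → j * l j)

doubleSum : (ℕ → ℕ) → ℕ → ℕ
doubleSum l = sumTo (λ j → 2 * l j)

IsL : (ℕ → ℕ) → (ℕ → ℕ) → Set
IsL ν l =
  (l 1 ≡ (ν 2 ∸ 1) ⊔ 1) ×
  (∀ i → 2 ≤ i →
     (1 ≤ l i) ×
     (ν (suc i) ∸ 1 ≤ weightedSum l (i ∸ 1) + i * l i) ×
     (∀ k → 1 ≤ k → k < l i → weightedSum l (i ∸ 1) + i * k < ν (suc i) ∸ 1))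

-- n / d as a rational number (junk value 0 when d = 0; never used at d = 0 below)
_//_ : ℕ → ℕ → ℚ
n // zero = 0ℚ
n // suc d = (+ n) / suc d

f : (ℕ → ℕ) → ℕ → ℕ → ℕ → ℚ
f l i w z = (doubleSum l i + 2 * w + z) // (weightedSum l i + suc i * w + z)

-- Write D = Σ_{j≤i} 2 l_j and W = Σ_{j≤i} j l_j.  After cross-multiplying,
-- the claim (D + 2w + z)/(W + (i+1)w + z) < (D + i + 1)/(W + i + 1) becomes
--
--   (D+i+1)(W+(i+1)w+z) − (D+2w+z)(W+i+1)
--     = w·((i+1)D − 2W + (i+1)(i−1)) + (i+1−z)(W−D),
--
-- whose first summand is non-negative as soon as i ≥ 1 and 2W ≤ iD, and whose
-- second summand is positive because z ≤ i and D < W.  The bound 2W ≤ iD holds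
-- for every sequence l, since each term j l_j of W has j ≤ i.
module Submission where

open import Defs
open import Data.Nat using (ℕ; zero; suc; _+_; _*_; _≤_; _<_; z≤n; s≤s)
open import Data.Rational using () renaming (_<_ to _<ℚ_)
open import Data.Nat.Properties
open import Data.Nat.Tactic.RingSolver using (solve-∀)
import Data.Integer as ℤ
import Data.Integer.Properties as ℤ
open import Data.Rational.Properties using (toℚᵘ-cancel-<; toℚᵘ-fromℚᵘ)
import Data.Rational.Unnormalised.Base as ℚᵘ
import Data.Rational.Unnormalised.Properties as ℚᵘ
open import Data.Product using (_,_)
open import Relation.Binary.PropositionalEquality

-- Fractions of naturals with positive denominators are compared by
-- cross-multiplication.  (n // suc a) unfolds to the normalisation of the
-- unnormalised rational n/(a+1), which is order-equivalent to it.
fraction-< : ∀ {n m d d'} → 0 < d → 0 < d' → n * d' < m * d → n // d <ℚ m // d'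
fraction-< {n} {m} {suc a} {suc b} _ _ cross =
  toℚᵘ-cancel-<
    (ℚᵘ.<-respˡ-≃ (ℚᵘ.≃-sym (toℚᵘ-fromℚᵘ (ℚᵘ.mkℚᵘ (ℤ.+ n) a)))
      (ℚᵘ.<-respʳ-≃ (ℚᵘ.≃-sym (toℚᵘ-fromℚᵘ (ℚᵘ.mkℚᵘ (ℤ.+ m) b)))
        (ℚᵘ.*<* (subst₂ ℤ._<_ (ℤ.pos-* n (suc b)) (ℤ.pos-* m (suc a)) (ℤ.+<+ cross)))))

-- 2 Σ_{j≤i} j l_j ≤ i Σ_{j≤i} 2 l_j, for every sequence l: termwise, j ≤ i.
weightedSum-bound : ∀ l i → 2 * weightedSum l i ≤ i * doubleSum l i
weightedSum-bound l zero = z≤n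
weightedSum-bound l (suc i) = begin
  2 * (W + suc i * L)             ≡⟨ *-distribˡ-+ 2 W (suc i * L) ⟩
  2 * W + 2 * (suc i * L)         ≡⟨ cong (2 * W +_) (swap-factors 2 (suc i) L) ⟩
  2 * W + suc i * (2 * L)         ≤⟨ +-monoˡ-≤ (suc i * (2 * L)) 2W≤suc-i*D ⟩
  suc i * D + suc i * (2 * L)     ≡⟨ *-distribˡ-+ (suc i) D (2 * L) ⟨
  suc i * (D + 2 * L)             ∎
  where
    open ≤-Reasoning
    W = weightedSum l i
    D = doubleSum l i
    L = l (suc i)
    swap-factors : ∀ a b c → a * (b * c) ≡ b * (a * c)
    swap-factors = solve-∀
    2W≤suc-i*D : 2 * W ≤ suc i * D
    2W≤suc-i*D = ≤-trans (weightedSum-bound l i) (m≤n+m (i * D) D)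

-- Cross-multiplied difference of the two fractions, written without
-- subtraction for W = D + 1 + d and i = z + t:  R + X = L + Y + (t+1)(d+1)
-- with X = w·2W + w(i+1) and Y = w(i+1)D + w(i+1)i.
cross-identity : ∀ D d w z t →
  (D + suc (z + t)) * (suc D + d + suc (z + t) * w + z)
    + (w * (2 * (suc D + d)) + w * suc (z + t))
  ≡ (D + 2 * w + z) * (suc D + d + suc (z + t))
    + (w * (suc (z + t) * D) + w * (suc (z + t) * (z + t)))
    + suc t * suc d
cross-identity = solve-∀

<-from-identity : ∀ {L R X Y c} → X ≤ Y → R + X ≡ L + Y + suc c → L < R
<-from-identity {L} {R} {X} {Y} {c} X≤Y eq = +-cancelʳ-< Y L R (begin-strict
  L + Y            <⟨ m<m+n (L + Y) (s≤s z≤n) ⟩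
  L + Y + suc c    ≡⟨ eq ⟨
  R + X            ≤⟨ +-monoʳ-≤ R X≤Y ⟩
  R + Y            ∎)
  where open ≤-Reasoning

cross-< : ∀ {D W i w z} → D < W → z ≤ i → 1 ≤ i → 2 * W ≤ i * D →
  (D + 2 * w + z) * (W + suc i) < (D + suc i) * (W + suc i * w + z)
cross-< {D} {W} {i} {w} {z} D<W z≤i 1≤i 2W≤iD
  with m≤n⇒∃[o]m+o≡n D<W | m≤n⇒∃[o]m+o≡n z≤i
... | d , refl | t , refl =
  <-from-identity (+-mono-≤ (*-monoʳ-≤ w 2W≤suc-i*D) (*-monoʳ-≤ w suc-i≤suc-i*i))
                  (cross-identity D d w z t)
  where
    2W≤suc-i*D : 2 * W ≤ suc i * D
    2W≤suc-i*D = ≤-trans 2W≤iD (m≤n+m (i * D) D)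
    suc-i≤suc-i*i : suc i ≤ suc i * i
    suc-i≤suc-i*i = ≤-trans (≤-reflexive (sym (*-identityʳ (suc i)))) (*-monoʳ-≤ (suc i) 1≤i)

mainTheorem14 : (q : ℕ → ℕ) → Basic q → InfiniteInLimit q →
    (ν l : ℕ → ℕ) → IsNu q ν → IsL ν l →
    (i : ℕ) → 2 < i → doubleSum l i < weightedSum l i →
    (w z : ℕ) → w ≤ l (suc i) → z ≤ i →
    f l i w z <ℚ f l i 0 (suc i)
mainTheorem14 _ _ _ _ l _ _ i 2<i D<W w z _ z≤i =
  subst (f l i w z <ℚ_) (sym right-endpoint)
    (fraction-< (<-≤-trans 0<W (≤-trans (m≤m+n W (suc i * w)) (m≤m+n _ z)))
                (≤-trans (s≤s z≤n) (m≤n+m (suc i) W))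
                (cross-< D<W z≤i (≤-trans (s≤s z≤n) 2<i) (weightedSum-bound l i)))
  where
    D = doubleSum l i
    W = weightedSum l i
    0<W : 0 < W
    0<W = ≤-<-trans z≤n D<W
    right-endpoint : f l i 0 (suc i) ≡ (D + suc i) // (W + suc i)
    right-endpoint = cong₂ (λ n d → (n + suc i) // (d + suc i))
      (+-identityʳ D) (trans (cong (W +_) (*-zeroʳ (suc i))) (+-identityʳ W))
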